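{- Let $m>1$ be an integer. Then \[ |\mathcal{F}(\mathbb{B}(2m),m)|-1=\sum_{d\geq 1}\mu(d)\left\lfloor\frac{m}{d}\right\rfloor \left\lfloor\frac{m}{d}+1\right\rfloor . \]
   Context: $\mu$ is the Möbius function. For a positive integer $n$, $\mathcal{F}_n$ is the Farey sequence of order $n$: the ascending sequence of irreducible fractions $\frac hk$ with integers $0\le h\le k\le n$, $k\ge1$. For a positive integer $m$, $\mathcal{F}(\mathbb{B}(2m),m)$ is the ascending sequence $\left(\frac{h}{k}\in\mathcal{F}_{2m}:\ h\le m,\ k-h\le m\right)$, and $|\cdot|$ denotes its number of terms. -}

module Defs where

open import Data.Nat using (ℕ; zero; suc; _+_; _*_; _∸_; _≤_; _≤?_)
open import Data.Nat.Divisibility using (_∣?_)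
open import Data.Nat.GCD using (gcd)
open import Data.Nat.Primality using (prime?)
open import Data.Nat.DivMod using (_/_)
open import Data.Integer as ℤ using (ℤ)
open import Data.List using (List; []; _∷_; length; filter; map; concatMap; upTo; sum; foldr)
open import Data.Product using (_×_; _,_; proj₁; proj₂)
open import Data.Bool using (Bool; true; false; if_then_else_; _∧_; not)
open import Relation.Nullary.Decidable using (⌊_⌋)
import Data.List

range : ℕ → ℕ → List ℕ
range a b = map (λ i → a + i) (upTo (suc b ∸ a))

ω : ℕ → ℕ
ω n = length (filter (λ p → prime? p) (filter (λ p → p ∣? n) (range 1 n)))

squarefree : ℕ → Bool
squarefree n = Data.List.null (filter (λ d → (d * d) ∣? n) (range 2 n))

sign : ℕ → ℤ
sign zero = ℤ.+ 1
sign (suc k) = ℤ.- sign k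

-- Möbius function (value at 0 is irrelevant; set to 0)
μ : ℕ → ℤ
μ zero = ℤ.+ 0
μ n@(suc _) = if squarefree n then sign (ω n) else ℤ.+ 0

-- Farey sequence of order n: irreducible fractions h/k, 0 ≤ h ≤ k ≤ n, k ≥ 1,
-- each represented by its unique reduced pair (h , k)
Farey : ℕ → List (ℕ × ℕ)
Farey n = concatMap (λ k → map (λ h → (h , k))
            (filter (λ h → gcd h k Data.Nat.≟ 1) (range 0 k))) (range 1 n)

FareyB : ℕ → List (ℕ × ℕ)
FareyB m = filter (λ p → (proj₁ p ≤? m) Relation.Nullary.Decidable.×-dec (proj₂ p ∸ proj₁ p ≤? m)) (Farey (2 * m))
  where import Relation.Nullary.Decidable

-- ∑_{d=1}^{m} μ(d) ⌊m/d⌋ ⌊m/d + 1⌋   (terms with d > m vanish since ⌊m/d⌋ = 0)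
rhs : ℕ → ℤ
rhs m = foldr ℤ._+_ (ℤ.+ 0) (map (λ i → term (suc i)) (upTo m))
  where
  term : ℕ → ℤ
  term zero = ℤ.+ 0
  term d@(suc _) = μ d ℤ.* ((ℤ.+ (m / d)) ℤ.* (ℤ.+ ((m / d) + 1)))

-- Writing k = h + b, the fractions h/k of 𝓕(𝔹(2m), m) are the pairs (h , b) with
-- 0 ≤ h , b ≤ m and gcd h b = 1, because gcd h (h + b) = gcd h b.  The row h = 0
-- contributes only 0/1, the "− 1"; on the rows 1 ≤ a ≤ m Möbius inversion
-- [gcd a b = 1] = ∑_{d ∣ a, d ∣ b} μ d turns the count into
-- ∑_d μ d · #{1 ≤ a ≤ m : d ∣ a} · #{0 ≤ b ≤ m : d ∣ b} = ∑_d μ d ⌊m/d⌋ (⌊m/d⌋ + 1).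
-- The identity ∑_{d ∣ n} μ d = [n = 1] is derived from the explicit definition of μ:
-- for a prime p ∣ n, the divisors p e with p ∤ e cancel the divisors e with p ∤ e,
-- since μ (p e) = − μ e, and the divisors p e with p ∣ e have μ (p e) = 0.

module Submission where

open import Defs
open import Data.Nat using (ℕ; _<_)
open import Data.List using (length)
open import Data.Integer using (+_; _-_)
open import Relation.Binary.PropositionalEquality using (_≡_)

open import Data.Bool using (true; false; if_then_else_)
import Data.Bool.Properties as Bool
open import Data.Integer using (ℤ; -_; _+_; _*_)
import Data.Integer.Properties as ℤ
open import Algebra.Properties.AbelianGroup ℤ.+-0-abelianGroup using (xyx⁻¹≈y) renaming (∙-cancelˡ to +-cancelˡ)
open import Data.Integer.Tactic.RingSolver using (solve-∀)
open import Data.List using (List; []; _∷_; _++_; map; foldr; filter; concatMap; applyUpTo; upTo; null)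
open import Data.List.Membership.Propositional using (_∈_)
open import Data.List.Membership.Propositional.Properties using (∈-map⁺; ∈-map⁻; ∈-upTo⁺; ∈-filter⁺)
open import Data.List.Properties using (map-∘; filter-none)
import Data.List.Relation.Unary.All as All
open import Data.List.Relation.Unary.All using (_∷_)
open import Data.List.Relation.Unary.Any using (here; there)
open import Data.Nat as ℕ using (zero; suc; NonZero; z≤n; s≤s; z<s; s<s; _≤_; _≤?_; _<?_; _∸_; _≟_)
import Data.Nat.Properties as ℕ
open import Data.Nat.Coprimality as Coprimality using (Coprime; coprime-divisor; coprime⇒gcd≡1; gcd≡1⇒coprime; coprime-+)
open import Data.Nat.Divisibility
  using (_∣_; _∣?_; _∣0; 0∣⇒≡0; >⇒∤; ∣⇒≤; ∣-refl; ∣-trans; ∣1⇒≡1; ∣n⇒∣m*n; m∣m*n; m*n∣⇒n∣; ∣m+n∣m⇒∣n; ∣m∣n⇒∣m+n;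
         *-pres-∣; *-monoʳ-∣; *-cancelˡ-∣)
open import Data.Nat.DivMod using (_/_; m<n⇒m/n≡0; m/n≡1+[m∸n]/n)
open import Data.Nat.GCD using (gcd; gcd[m,n]∣m; gcd[m,n]∣n; gcd-greatest; gcd[m,n]≢0; gcd-identityˡ)
open import Data.Nat.Induction using (<-wellFounded)
open import Data.Nat.LCM using (lcm; lcm-least; gcd*lcm)
open import Data.Nat.Primality using (Prime; prime?; ¬prime[1]; prime⇒irreducible; prime⇒nonZero; prime⇒nonTrivial; euclidsLemma)
open import Data.Nat.Primality.Factorisation using (factorise)
open import Data.Product using (_×_; _,_; proj₁; proj₂; ∃-syntax; uncurry)
open import Data.Sum using (inj₁; inj₂; [_,_]′)
open import Function using (_∘_; id)
open import Function.Bundles using (mk⇔)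
open import Induction.WellFounded using (Acc; acc)
open import Relation.Binary.PropositionalEquality using (refl; sym; trans; cong; cong₂; subst; _≢_; module ≡-Reasoning)
open import Relation.Nullary using (Dec; yes; no; _because_; ¬_; ¬?; contradiction)
open import Relation.Nullary.Decidable using (_×-dec_)
open import Relation.Unary using (Pred; Decidable)

∑ : ℕ → (ℕ → ℤ) → ℤ
∑ zero    f = + 0
∑ (suc n) f = f 0 + ∑ n (λ i → f (suc i))

infix 5 ∑
syntax ∑ n (λ i → f) = ∑[ i < n ] f

∑-cong : ∀ n {f g : ℕ → ℤ} → (∀ i → i < n → f i ≡ g i) → ∑ n f ≡ ∑ n g
∑-cong zero    eq = refl
∑-cong (suc n) eq = cong₂ _+_ (eq 0 z<s) (∑-cong n (λ i i<n → eq (suc i) (s<s i<n)))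

∑-zero : ∀ n {f : ℕ → ℤ} → (∀ i → i < n → f i ≡ + 0) → ∑ n f ≡ + 0
∑-zero zero    f≡0 = refl
∑-zero (suc n) f≡0 = cong₂ _+_ (f≡0 0 z<s) (∑-zero n (λ i i<n → f≡0 (suc i) (s<s i<n)))

∑-distrib-+ : ∀ n (f g : ℕ → ℤ) → ∑[ i < n ] f i + g i ≡ (∑[ i < n ] f i) + (∑[ i < n ] g i)
∑-distrib-+ zero    f g = refl
∑-distrib-+ (suc n) f g = trans (cong (_+_ (f 0 + g 0)) (∑-distrib-+ n _ _)) (swap (f 0) (g 0) _ _)
  where
  swap : ∀ a b c d → a + b + (c + d) ≡ a + c + (b + d)
  swap = solve-∀

∑-*ˡ : ∀ n c (f : ℕ → ℤ) → ∑[ i < n ] c * f i ≡ c * (∑[ i < n ] f i)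
∑-*ˡ zero    c f = sym (ℤ.*-zeroʳ c)
∑-*ˡ (suc n) c f = trans (cong (_+_ (c * f 0)) (∑-*ˡ n c _)) (sym (ℤ.*-distribˡ-+ c (f 0) _))

∑-*ʳ : ∀ n c (f : ℕ → ℤ) → ∑[ i < n ] f i * c ≡ (∑[ i < n ] f i) * c
∑-*ʳ n c f = begin
  ∑[ i < n ] f i * c          ≡⟨ ∑-cong n (λ i _ → ℤ.*-comm (f i) c) ⟩
  ∑[ i < n ] c * f i          ≡⟨ ∑-*ˡ n c f ⟩
  c * (∑[ i < n ] f i)        ≡⟨ ℤ.*-comm c _ ⟩
  (∑[ i < n ] f i) * c        ∎
  where open ≡-Reasoning

∑-neg : ∀ n (f : ℕ → ℤ) → ∑[ i < n ] - f i ≡ - (∑[ i < n ] f i)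
∑-neg zero    f = refl
∑-neg (suc n) f = trans (cong (_+_ (- f 0)) (∑-neg n _)) (sym (ℤ.neg-distrib-+ (f 0) _))

∑-comm : ∀ m n (f : ℕ → ℕ → ℤ) → ∑[ i < m ] ∑[ j < n ] f i j ≡ ∑[ j < n ] ∑[ i < m ] f i j
∑-comm zero    n f = sym (∑-zero n (λ _ _ → refl))
∑-comm (suc m) n f = begin
  (∑[ j < n ] f 0 j) + (∑[ i < m ] ∑[ j < n ] f (suc i) j) ≡⟨ cong (_+_ (∑ n (f 0))) (∑-comm m n (λ i → f (suc i))) ⟩
  (∑[ j < n ] f 0 j) + (∑[ j < n ] ∑[ i < m ] f (suc i) j) ≡⟨ ∑-distrib-+ n _ _ ⟨
  ∑[ j < n ] ∑[ i < suc m ] f i j                           ∎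
  where open ≡-Reasoning

∑-split : ∀ m n (f : ℕ → ℤ) → ∑[ i < m ℕ.+ n ] f i ≡ (∑[ i < m ] f i) + (∑[ i < n ] f (m ℕ.+ i))
∑-split zero    n f = sym (ℤ.+-identityˡ _)
∑-split (suc m) n f = trans (cong (_+_ (f 0)) (∑-split m n _)) (sym (ℤ.+-assoc (f 0) _ _))

∑-last : ∀ n (f : ℕ → ℤ) → ∑[ i < suc n ] f i ≡ (∑[ i < n ] f i) + f n
∑-last zero    f = ℤ.+-comm (f 0) (+ 0)
∑-last (suc n) f = trans (cong (_+_ (f 0)) (∑-last n _)) (sym (ℤ.+-assoc (f 0) _ _))

∑-extend : ∀ n N {f : ℕ → ℤ} → n ≤ N → (∀ i → n ≤ i → f i ≡ + 0) → ∑ N f ≡ ∑ n f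
∑-extend zero    N       n≤N       f≡0 = ∑-zero N (λ i _ → f≡0 i z≤n)
∑-extend (suc n) (suc N) {f} (s≤s n≤N) f≡0 = cong (_+_ (f 0)) (∑-extend n N n≤N (λ i n≤i → f≡0 (suc i) (s≤s n≤i)))

∑-single : ∀ N a {f : ℕ → ℤ} → a < N → (∀ i → i < N → i ≢ a → f i ≡ + 0) → ∑ N f ≡ f a
∑-single (suc N) zero    {f} _         f≡0 =
  trans (cong (_+_ (f 0)) (∑-zero N (λ i i<N → f≡0 (suc i) (s<s i<N) λ ()))) (ℤ.+-identityʳ (f 0))
∑-single (suc N) (suc a) {f} (s≤s a<N) f≡0 =
  trans (cong (λ x → x + (∑[ i < N ] f (suc i))) (f≡0 0 z<s λ ())) (trans (ℤ.+-identityˡ _)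
    (∑-single N a a<N (λ i i<N i≢a → f≡0 (suc i) (s<s i<N) (i≢a ∘ ℕ.suc-injective))))

∑-triangle : ∀ N (f : ℕ → ℕ → ℤ) →
  ∑[ k < N ] ∑[ h < suc k ] f h k ≡ ∑[ h < N ] ∑[ b < N ∸ h ] f h (h ℕ.+ b)
∑-triangle zero    f = refl
∑-triangle (suc N) f = begin
  ∑[ k < suc N ] ∑[ h < suc k ] f h k
    ≡⟨ ∑-last N _ ⟩
  (∑[ k < N ] ∑[ h < suc k ] f h k) + (∑[ h < suc N ] f h N)
    ≡⟨ cong (λ x → x + (∑[ h < suc N ] f h N)) (∑-triangle N f) ⟩
  (∑[ h < N ] row N h) + (∑[ h < suc N ] f h N)
    ≡⟨ cong (λ x → x + (∑[ h < suc N ] f h N)) (sym (trans (∑-last N _) (last-row-empty N))) ⟩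
  (∑[ h < suc N ] row N h) + (∑[ h < suc N ] f h N)
    ≡⟨ ∑-distrib-+ (suc N) (row N) (λ h → f h N) ⟨
  ∑[ h < suc N ] row N h + f h N
    ≡⟨ ∑-cong (suc N) (λ h h<1+N → sym (row-suc h (ℕ.≤-pred h<1+N))) ⟩
  ∑[ h < suc N ] row (suc N) h
    ∎
  where
  open ≡-Reasoning
  row : ℕ → ℕ → ℤ
  row N h = ∑[ b < N ∸ h ] f h (h ℕ.+ b)
  last-row-empty : ∀ N → (∑[ h < N ] row N h) + row N N ≡ ∑[ h < N ] row N h
  last-row-empty N = trans (cong (λ L → (∑[ h < N ] row N h) + ∑ L (λ b → f N (N ℕ.+ b))) (ℕ.n∸n≡0 N)) (ℤ.+-identityʳ _)
  row-suc : ∀ h → h ≤ N → row (suc N) h ≡ row N h + f h N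
  row-suc h h≤N = begin
    ∑[ b < suc N ∸ h ] f h (h ℕ.+ b)     ≡⟨ cong (λ L → ∑ L (λ b → f h (h ℕ.+ b))) (ℕ.+-∸-assoc 1 h≤N) ⟩
    ∑[ b < suc (N ∸ h) ] f h (h ℕ.+ b)   ≡⟨ ∑-last (N ∸ h) _ ⟩
    row N h + f h (h ℕ.+ (N ∸ h))        ≡⟨ cong (λ k → row N h + f h k) (ℕ.m+[n∸m]≡n h≤N) ⟩
    row N h + f h N                      ∎

𝟙 : ∀ {p} {P : Set p} → Dec P → ℤ
𝟙 (true  because _) = + 1
𝟙 (false because _) = + 0

module _ {p} {P : Set p} where

  𝟙-yes : (P? : Dec P) → P → 𝟙 P? ≡ + 1
  𝟙-yes (yes _) _ = refl
  𝟙-yes (no ¬p) p = contradiction p ¬p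

  𝟙-no : (P? : Dec P) → ¬ P → 𝟙 P? ≡ + 0
  𝟙-no (yes p) ¬p = contradiction p ¬p
  𝟙-no (no _)  _  = refl

  𝟙-split : (P? : Dec P) → ∀ x → x ≡ 𝟙 P? * x + 𝟙 (¬? P?) * x
  𝟙-split (yes _) x = sym (trans (cong (_+_ (+ 1 * x)) (ℤ.*-zeroˡ x)) (trans (ℤ.+-identityʳ _) (ℤ.*-identityˡ x)))
  𝟙-split (no _)  x = sym (trans (cong (λ y → y + + 1 * x) (ℤ.*-zeroˡ x)) (trans (ℤ.+-identityˡ _) (ℤ.*-identityˡ x)))

module _ {p q} {P : Set p} {Q : Set q} where

  𝟙-cong : (P? : Dec P) (Q? : Dec Q) → (P → Q) → (Q → P) → 𝟙 P? ≡ 𝟙 Q?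
  𝟙-cong P? (yes q) _   Q⇒P = 𝟙-yes P? (Q⇒P q)
  𝟙-cong P? (no ¬q) P⇒Q _   = 𝟙-no P? (¬q ∘ P⇒Q)

  𝟙-× : (P? : Dec P) (Q? : Dec Q) → 𝟙 (P? ×-dec Q?) ≡ 𝟙 P? * 𝟙 Q?
  𝟙-× (yes _) (yes _) = refl
  𝟙-× (yes _) (no _)  = refl
  𝟙-× (no _)  _       = refl

∑-restrict : ∀ m N (f : ℕ → ℤ) → m < N → ∑[ i < N ] 𝟙 (i ≤? m) * f i ≡ ∑[ i < suc m ] f i
∑-restrict m N f m<N = begin
  ∑[ i < N ] 𝟙 (i ≤? m) * f i       ≡⟨ ∑-extend (suc m) N m<N (λ i m<i → trans (cong (_* f i) (𝟙-no (i ≤? m) (ℕ.<⇒≱ m<i))) (ℤ.*-zeroˡ (f i))) ⟩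
  ∑[ i < suc m ] 𝟙 (i ≤? m) * f i   ≡⟨ ∑-cong (suc m) (λ i i≤m → trans (cong (_* f i) (𝟙-yes (i ≤? m) (ℕ.≤-pred i≤m))) (ℤ.*-identityˡ (f i))) ⟩
  ∑[ i < suc m ] f i                ∎
  where open ≡-Reasoning

-- Chosen so that rhs m unfolds definitionally to ∑ₗ (upTo m) _.
∑ₗ : ∀ {a} {A : Set a} → List A → (A → ℤ) → ℤ
∑ₗ xs f = foldr _+_ (+ 0) (map f xs)

∑ₗ-++ : ∀ {a} {A : Set a} (xs ys : List A) f → ∑ₗ (xs ++ ys) f ≡ ∑ₗ xs f + ∑ₗ ys f
∑ₗ-++ []       ys f = sym (ℤ.+-identityˡ _)
∑ₗ-++ (x ∷ xs) ys f = trans (cong (_+_ (f x)) (∑ₗ-++ xs ys f)) (sym (ℤ.+-assoc (f x) _ _))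

module _ {a} {A : Set a} where

  ∑ₗ-map : ∀ {b} {B : Set b} (g : A → B) xs f → ∑ₗ (map g xs) f ≡ ∑ₗ xs (f ∘ g)
  ∑ₗ-map g xs f = cong (foldr _+_ (+ 0)) (sym (map-∘ {g = f} {f = g} xs))

  ∑ₗ-concatMap : ∀ {b} {B : Set b} (g : A → List B) xs f → ∑ₗ (concatMap g xs) f ≡ ∑ₗ xs (λ x → ∑ₗ (g x) f)
  ∑ₗ-concatMap g []       f = refl
  ∑ₗ-concatMap g (x ∷ xs) f = trans (∑ₗ-++ (g x) (concatMap g xs) f) (cong (_+_ (∑ₗ (g x) f)) (∑ₗ-concatMap g xs f))

  module _ {p} {P : Pred A p} (P? : Decidable P) where

    ∑ₗ-filter : ∀ xs f → ∑ₗ (filter P? xs) f ≡ ∑ₗ xs (λ x → 𝟙 (P? x) * f x)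
    ∑ₗ-filter []       f = refl
    ∑ₗ-filter (x ∷ xs) f with P? x
    ... | yes _ = cong₂ _+_ (sym (ℤ.*-identityˡ (f x))) (∑ₗ-filter xs f)
    ... | no _  = trans (∑ₗ-filter xs f) (sym (ℤ.+-identityˡ _))

    length-filter≡∑ₗ : ∀ xs → + length (filter P? xs) ≡ ∑ₗ xs (λ x → 𝟙 (P? x))
    length-filter≡∑ₗ []       = refl
    length-filter≡∑ₗ (x ∷ xs) with P? x
    ... | yes _ = trans (ℤ.pos-+ 1 _) (cong (_+_ (+ 1)) (length-filter≡∑ₗ xs))
    ... | no _  = trans (length-filter≡∑ₗ xs) (sym (ℤ.+-identityˡ _))

∑ₗ-applyUpTo : ∀ (g : ℕ → ℕ) n f → ∑ₗ (applyUpTo g n) f ≡ ∑[ i < n ] f (g i)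
∑ₗ-applyUpTo g zero    f = refl
∑ₗ-applyUpTo g (suc n) f = cong (_+_ (f (g 0))) (∑ₗ-applyUpTo (g ∘ suc) n f)

∑ₗ-upTo : ∀ n f → ∑ₗ (upTo n) f ≡ ∑[ i < n ] f i
∑ₗ-upTo = ∑ₗ-applyUpTo (λ i → i)

∑ₗ-range : ∀ a b f → ∑ₗ (range a b) f ≡ ∑[ i < suc b ∸ a ] f (a ℕ.+ i)
∑ₗ-range a b f = trans (∑ₗ-map (a ℕ.+_) (upTo (suc b ∸ a)) f) (∑ₗ-upTo (suc b ∸ a) _)

∈-range⁺ : ∀ {a b x} → a ≤ x → x ≤ b → x ∈ range a b
∈-range⁺ {a} {b} a≤x x≤b =
  subst (_∈ range a b) (ℕ.m+[n∸m]≡n a≤x) (∈-map⁺ (a ℕ.+_) (∈-upTo⁺ (ℕ.∸-monoˡ-< (s≤s x≤b) a≤x)))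

∈-range⇒≤ : ∀ {a b x} → x ∈ range a b → a ≤ x
∈-range⇒≤ {a} x∈ with ∈-map⁻ (a ℕ.+_) x∈
... | i , _ , refl = ℕ.m≤m+n a i

Squarefree : ℕ → Set
Squarefree n = ∀ d → 2 ≤ d → ¬ (d ℕ.* d ∣ n)

Squarefree⇒squarefree : ∀ {n} → Squarefree n → squarefree n ≡ true
Squarefree⇒squarefree {n} sf =
  cong null (filter-none (λ d → d ℕ.* d ∣? n) {range 2 n} (All.tabulate (λ d∈ → sf _ (∈-range⇒≤ {b = n} d∈))))

squarefree≡false : ∀ {n d} .{{_ : NonZero n}} → 2 ≤ d → d ℕ.* d ∣ n → squarefree n ≡ false
squarefree≡false {n} {d} 2≤d dd∣n = nonempty (∈-filter⁺ (λ d → d ℕ.* d ∣? n) (∈-range⁺ 2≤d d≤n) dd∣n)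
  where
  d≤n : d ≤ n
  d≤n = ℕ.≤-trans (ℕ.m≤m*n d d {{ℕ.>-nonZero (ℕ.≤-trans (s≤s z≤n) 2≤d)}}) (∣⇒≤ dd∣n)
  nonempty : ∀ {x} {xs : List ℕ} → x ∈ xs → null xs ≡ false
  nonempty (here _)  = refl
  nonempty (there _) = refl

squarefree⇒Squarefree : ∀ {n} .{{_ : NonZero n}} → squarefree n ≡ true → Squarefree n
squarefree⇒Squarefree sq d 2≤d dd∣n with () ← trans (sym sq) (squarefree≡false 2≤d dd∣n)

prime∤⇒coprime : ∀ {p e} → Prime p → ¬ p ∣ e → Coprime p e
prime∤⇒coprime pp p∤e {i} (i∣p , i∣e) with prime⇒irreducible pp i∣p
... | inj₁ i≡1 = i≡1
... | inj₂ refl = contradiction i∣e p∤e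

prime∤⇒nonZero : ∀ {p e} → Prime p → ¬ p ∣ e → NonZero e
prime∤⇒nonZero {p} {zero}  _ p∤0 = contradiction (p ∣0) p∤0
prime∤⇒nonZero {e = suc _} _ _   = _

Squarefree-* : ∀ {p e} → Prime p → ¬ p ∣ e → Squarefree e → Squarefree (p ℕ.* e)
Squarefree-* {p} {e} pp p∤e sf d 2≤d dd∣pe with p ∣? d
... | yes p∣d = p∤e (*-cancelˡ-∣ p {{prime⇒nonZero pp}} (∣-trans (*-pres-∣ p∣d p∣d) dd∣pe))
... | no  p∤d = sf d 2≤d (coprime-divisor (Coprimality.sym dd-coprime-p) dd∣pe)
  where
  dd-coprime-p : Coprime p (d ℕ.* d)
  dd-coprime-p = prime∤⇒coprime pp ([ p∤d , p∤d ]′ ∘ euclidsLemma d d pp)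

squarefree-* : ∀ {p e} → Prime p → ¬ p ∣ e → squarefree (p ℕ.* e) ≡ squarefree e
squarefree-* {p} {e} pp p∤e = Bool.⇔→≡ (mk⇔
  (λ sq → Squarefree⇒squarefree (λ d 2≤d dd∣e → squarefree⇒Squarefree {{pe≢0}} sq d 2≤d (∣n⇒∣m*n p dd∣e)))
  (λ sq → Squarefree⇒squarefree (Squarefree-* pp p∤e (squarefree⇒Squarefree {{e≢0}} sq))))
  where
  e≢0 = prime∤⇒nonZero pp p∤e
  pe≢0 = ℕ.m*n≢0 p e {{prime⇒nonZero pp}} {{e≢0}}

𝟙-primeDivisor : ℕ → ℕ → ℤ
𝟙-primeDivisor n q = 𝟙 (q ∣? n) * 𝟙 (prime? q)

𝟙-primeDivisor-∤ : ∀ {n q} → ¬ q ∣ n → 𝟙-primeDivisor n q ≡ + 0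
𝟙-primeDivisor-∤ {n} {q} q∤n = trans (cong (_* 𝟙 (prime? q)) (𝟙-no (q ∣? n) q∤n)) (ℤ.*-zeroˡ (𝟙 (prime? q)))

ω-as-∑ : ∀ n .{{_ : NonZero n}} N → n < N → + ω n ≡ ∑[ q < N ] 𝟙-primeDivisor n q
ω-as-∑ n N n<N = begin
  + ω n                                            ≡⟨ length-filter≡∑ₗ prime? (filter (_∣? n) (range 1 n)) ⟩
  ∑ₗ (filter (_∣? n) (range 1 n)) (𝟙 ∘ prime?)     ≡⟨ ∑ₗ-filter (_∣? n) (range 1 n) (𝟙 ∘ prime?) ⟩
  ∑ₗ (range 1 n) (𝟙-primeDivisor n)                ≡⟨ ∑ₗ-range 1 n (𝟙-primeDivisor n) ⟩
  ∑[ i < n ] 𝟙-primeDivisor n (suc i)              ≡⟨ ℤ.+-identityˡ _ ⟨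
  + 0 + (∑[ i < n ] 𝟙-primeDivisor n (suc i))      ≡⟨ cong (λ x → x + (∑[ i < n ] 𝟙-primeDivisor n (suc i))) (𝟙-primeDivisor-∤ 0∤n) ⟨
  ∑[ q < suc n ] 𝟙-primeDivisor n q                ≡⟨ ∑-extend (suc n) N n<N (λ q n<q → 𝟙-primeDivisor-∤ (>⇒∤ n<q)) ⟨
  ∑[ q < N ] 𝟙-primeDivisor n q                    ∎
  where
  open ≡-Reasoning
  0∤n : ¬ 0 ∣ n
  0∤n = ℕ.≢-nonZero⁻¹ n ∘ 0∣⇒≡0

𝟙-primeDivisor-* : ∀ {p e} → Prime p → ¬ p ∣ e → ∀ q →
  𝟙-primeDivisor (p ℕ.* e) q ≡ 𝟙-primeDivisor e q + 𝟙 (q ≟ p)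
𝟙-primeDivisor-* {p} {e} pp p∤e q with q ≟ p | prime? q
... | yes refl | p? = begin
  𝟙 (p ∣? p ℕ.* e) * 𝟙 p?           ≡⟨ cong₂ _*_ (𝟙-yes (p ∣? p ℕ.* e) (m∣m*n e)) (𝟙-yes p? pp) ⟩
  + 1                               ≡⟨ cong (λ x → x * 𝟙 p? + + 1) (𝟙-no (p ∣? e) p∤e) ⟨
  𝟙 (p ∣? e) * 𝟙 p? + + 1           ∎
  where open ≡-Reasoning
... | no _   | no _ = trans (ℤ.*-zeroʳ (𝟙 (q ∣? p ℕ.* e))) (sym (trans (ℤ.+-identityʳ _) (ℤ.*-zeroʳ (𝟙 (q ∣? e)))))
... | no q≢p | yes qp =
  trans (cong (_* + 1) (𝟙-cong (q ∣? p ℕ.* e) (q ∣? e) q∣pe⇒q∣e (∣n⇒∣m*n p))) (sym (ℤ.+-identityʳ _))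
  where
  q∣p⇒q≡p : q ∣ p → q ≡ p
  q∣p⇒q≡p q∣p = [ (λ q≡1 → contradiction (subst Prime q≡1 qp) ¬prime[1]) , id ]′ (prime⇒irreducible pp q∣p)
  q∣pe⇒q∣e : q ∣ p ℕ.* e → q ∣ e
  q∣pe⇒q∣e q∣pe = [ (λ q∣p → contradiction (q∣p⇒q≡p q∣p) q≢p) , id ]′ (euclidsLemma p e qp q∣pe)

ω-* : ∀ {p e} → Prime p → ¬ p ∣ e → ω (p ℕ.* e) ≡ suc (ω e)
ω-* {p} {e} pp p∤e = ℤ.+-injective (begin
  + ω (p ℕ.* e)                                             ≡⟨ ω-as-∑ (p ℕ.* e) N (ℕ.n<1+n _) ⟩
  ∑[ q < N ] 𝟙-primeDivisor (p ℕ.* e) q                     ≡⟨ ∑-cong N (λ q _ → 𝟙-primeDivisor-* pp p∤e q) ⟩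
  ∑[ q < N ] 𝟙-primeDivisor e q + 𝟙 (q ≟ p)                 ≡⟨ ∑-distrib-+ N (𝟙-primeDivisor e) (λ q → 𝟙 (q ≟ p)) ⟩
  (∑[ q < N ] 𝟙-primeDivisor e q) + (∑[ q < N ] 𝟙 (q ≟ p))  ≡⟨ cong₂ _+_ (sym (ω-as-∑ e N (s≤s (ℕ.m≤n*m e p)))) only-p ⟩
  + ω e + + 1                                               ≡⟨ cong +_ (ℕ.+-comm (ω e) 1) ⟩
  + suc (ω e)                                               ∎)
  where
  open ≡-Reasoning
  instance
    _ = prime⇒nonZero pp
    _ = prime∤⇒nonZero pp p∤e
    _ = ℕ.m*n≢0 p e
  N = suc (p ℕ.* e)
  only-p : ∑[ q < N ] 𝟙 (q ≟ p) ≡ + 1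
  only-p = trans (∑-single N p (s≤s (ℕ.m≤m*n p e)) (λ q _ q≢p → 𝟙-no (q ≟ p) q≢p)) (𝟙-yes (p ≟ p) refl)

μ-unfold : ∀ n .{{_ : NonZero n}} → μ n ≡ (if squarefree n then sign (ω n) else + 0)
μ-unfold (suc _) = refl

μ-* : ∀ {p e} → Prime p → ¬ p ∣ e → μ (p ℕ.* e) ≡ - μ e
μ-* {p} {e} pp p∤e = begin
  μ (p ℕ.* e)                                           ≡⟨ μ-unfold (p ℕ.* e) ⟩
  (if squarefree (p ℕ.* e) then sign (ω (p ℕ.* e)) else + 0)
    ≡⟨ cong₂ (λ b k → if b then sign k else + 0) (squarefree-* pp p∤e) (ω-* pp p∤e) ⟩
  (if squarefree e then sign (suc (ω e)) else + 0)      ≡⟨ if-neg (squarefree e) ⟩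
  - (if squarefree e then sign (ω e) else + 0)          ≡⟨ cong -_ (μ-unfold e) ⟨
  - μ e                                                 ∎
  where
  open ≡-Reasoning
  instance
    _ = prime⇒nonZero pp
    _ = prime∤⇒nonZero pp p∤e
    _ = ℕ.m*n≢0 p e
  if-neg : ∀ b → (if b then sign (suc (ω e)) else + 0) ≡ - (if b then sign (ω e) else + 0)
  if-neg true  = refl
  if-neg false = refl

μ-square : ∀ {d n} → 2 ≤ d → d ℕ.* d ∣ n → μ n ≡ + 0
μ-square {n = zero}      _   _     = refl
μ-square {n = n@(suc _)} 2≤d dd∣n = trans (μ-unfold n) (cong (λ b → if b then sign (ω n) else + 0) (squarefree≡false 2≤d dd∣n))

prime-divisor : ∀ n → 2 ≤ n → ∃[ p ] Prime p × p ∣ n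
prime-divisor n 2≤n with factorise n {{ℕ.>-nonZero (ℕ.<-trans z<s 2≤n)}}
... | record { factors = [] ; isFactorisation = n≡1 } = contradiction (subst (2 ≤_) n≡1 2≤n) λ { (s≤s ()) }
... | record { factors = p ∷ _ ; isFactorisation = refl ; factorsPrime = pp ∷ _ } = p , pp , m∣m*n _

𝟙-∣-+ : ∀ d b → 𝟙 (d ∣? d ℕ.+ b) ≡ 𝟙 (d ∣? b)
𝟙-∣-+ d b = 𝟙-cong (d ∣? d ℕ.+ b) (d ∣? b) (λ d∣d+b → ∣m+n∣m⇒∣n d∣d+b ∣-refl) (∣m∣n⇒∣m+n ∣-refl)

∑-multiples-below : ∀ d L (f : ℕ → ℤ) → 0 < L → L ≤ d → ∑[ i < L ] 𝟙 (d ∣? i) * f i ≡ f 0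
∑-multiples-below d L f 0<L L≤d = begin
  ∑[ i < L ] 𝟙 (d ∣? i) * f i   ≡⟨ ∑-single L 0 0<L (λ i i<L i≢0 →
                                   trans (cong (_* f i) (𝟙-no (d ∣? i) (>⇒∤ {{ℕ.≢-nonZero i≢0}} (ℕ.<-≤-trans i<L L≤d)))) (ℤ.*-zeroˡ (f i))) ⟩
  𝟙 (d ∣? 0) * f 0              ≡⟨ cong (_* f 0) (𝟙-yes (d ∣? 0) (d ∣0)) ⟩
  + 1 * f 0                     ≡⟨ ℤ.*-identityˡ (f 0) ⟩
  f 0                           ∎
  where open ≡-Reasoning

∑-multiples : ∀ p .{{_ : NonZero p}} K (f : ℕ → ℤ) →
  ∑[ i < p ℕ.* K ] 𝟙 (p ∣? i) * f i ≡ ∑[ e < K ] f (p ℕ.* e)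
∑-multiples p zero    f = cong (λ n → ∑[ i < n ] 𝟙 (p ∣? i) * f i) (ℕ.*-zeroʳ p)
∑-multiples p (suc K) f = begin
  ∑[ i < p ℕ.* suc K ] 𝟙 (p ∣? i) * f i
    ≡⟨ cong (λ n → ∑[ i < n ] 𝟙 (p ∣? i) * f i) (ℕ.*-suc p K) ⟩
  ∑[ i < p ℕ.+ p ℕ.* K ] 𝟙 (p ∣? i) * f i
    ≡⟨ ∑-split p (p ℕ.* K) _ ⟩
  (∑[ i < p ] 𝟙 (p ∣? i) * f i) + (∑[ i < p ℕ.* K ] 𝟙 (p ∣? p ℕ.+ i) * f (p ℕ.+ i))
    ≡⟨ cong₂ _+_ (∑-multiples-below p p f (ℕ.>-nonZero⁻¹ p) ℕ.≤-refl) (∑-cong (p ℕ.* K) (λ i _ → cong (_* f (p ℕ.+ i)) (𝟙-∣-+ p i))) ⟩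
  f 0 + (∑[ i < p ℕ.* K ] 𝟙 (p ∣? i) * f (p ℕ.+ i))
    ≡⟨ cong₂ _+_ (cong f (sym (ℕ.*-zeroʳ p))) (∑-multiples p K (f ∘ (p ℕ.+_))) ⟩
  f (p ℕ.* 0) + (∑[ e < K ] f (p ℕ.+ p ℕ.* e))
    ≡⟨ cong (_+_ (f (p ℕ.* 0))) (∑-cong K (λ e _ → cong f (ℕ.*-suc p e))) ⟨
  ∑[ e < suc K ] f (p ℕ.* e)
    ∎
  where
  open ≡-Reasoning

coprime-*-∣ : ∀ {m n o} → Coprime m n → m ∣ o → n ∣ o → m ℕ.* n ∣ o
coprime-*-∣ {m} {n} coprime m∣o n∣o = subst (_∣ _) lcm≡m*n (lcm-least m∣o n∣o)
  where
  lcm≡m*n : lcm m n ≡ m ℕ.* n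
  lcm≡m*n = trans (sym (ℕ.*-identityˡ _)) (subst (λ g → g ℕ.* lcm m n ≡ m ℕ.* n) (coprime⇒gcd≡1 coprime) (gcd*lcm m n))

divisorTerm-* : ∀ {p n} → Prime p → p ∣ n → ∀ e →
  𝟙 (p ℕ.* e ∣? n) * μ (p ℕ.* e) ≡ - (𝟙 (¬? (p ∣? e)) * (𝟙 (e ∣? n) * μ e))
divisorTerm-* {p} {n} pp p∣n e with p ∣? e
... | yes p∣e = trans (cong (_*_ (𝟙 (p ℕ.* e ∣? n))) (μ-square 2≤p (*-monoʳ-∣ p p∣e))) (ℤ.*-zeroʳ (𝟙 (p ℕ.* e ∣? n)))
  where
  2≤p : 2 ≤ p
  2≤p = ℕ.nonTrivial⇒n>1 p {{prime⇒nonTrivial pp}}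
... | no p∤e = begin
  𝟙 (p ℕ.* e ∣? n) * μ (p ℕ.* e)   ≡⟨ cong₂ _*_ (𝟙-cong (p ℕ.* e ∣? n) (e ∣? n) (m*n∣⇒n∣ p e) pe∣n) (μ-* pp p∤e) ⟩
  𝟙 (e ∣? n) * - μ e               ≡⟨ ℤ.neg-distribʳ-* (𝟙 (e ∣? n)) (μ e) ⟨
  - (𝟙 (e ∣? n) * μ e)             ≡⟨ cong -_ (ℤ.*-identityˡ _) ⟨
  - (+ 1 * (𝟙 (e ∣? n) * μ e))     ∎
  where
  open ≡-Reasoning
  pe∣n : e ∣ n → p ℕ.* e ∣ n
  pe∣n = coprime-*-∣ (prime∤⇒coprime pp p∤e) p∣n

divisorTerm-vanishes : ∀ {n} .{{_ : NonZero n}} d → n < d → 𝟙 (d ∣? n) * μ d ≡ + 0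
divisorTerm-vanishes {n} d n<d = trans (cong (_* μ d) (𝟙-no (d ∣? n) (>⇒∤ n<d))) (ℤ.*-zeroˡ (μ d))

∑-μ-divisors : ∀ n .{{_ : NonZero n}} N → n < N → ∑[ d < N ] 𝟙 (d ∣? n) * μ d ≡ 𝟙 (n ≟ 1)
∑-μ-divisors 1 N 1<N = ∑-single N 1 1<N (λ d _ d≢1 → trans (cong (_* μ d) (𝟙-no (d ∣? 1) (d≢1 ∘ ∣1⇒≡1))) (ℤ.*-zeroˡ (μ d)))
∑-μ-divisors n@(suc (suc _)) N n<N with prime-divisor n (s≤s (s≤s z≤n))
... | p , pp , p∣n = begin
  ∑[ d < N ] g d                                        ≡⟨ ∑-extend K N n<N divisorTerm-vanishes ⟩
  ∑[ d < K ] g d                                        ≡⟨ ∑-extend K M K≤M divisorTerm-vanishes ⟨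
  ∑[ d < M ] g d                                        ≡⟨ ∑-cong M (λ d _ → 𝟙-split (p ∣? d) (g d)) ⟩
  ∑[ d < M ] 𝟙 (p ∣? d) * g d + h d                     ≡⟨ ∑-distrib-+ M (λ d → 𝟙 (p ∣? d) * g d) h ⟩
  (∑[ d < M ] 𝟙 (p ∣? d) * g d) + (∑[ d < M ] h d)      ≡⟨ cong₂ _+_ (∑-multiples p K g) (∑-extend K M K≤M h-vanishes) ⟩
  (∑[ e < K ] g (p ℕ.* e)) + (∑[ e < K ] h e)           ≡⟨ cong (λ x → x + (∑[ e < K ] h e)) (∑-cong K (λ e _ → divisorTerm-* pp p∣n e)) ⟩
  (∑[ e < K ] - h e) + (∑[ e < K ] h e)                 ≡⟨ cong (λ x → x + (∑[ e < K ] h e)) (∑-neg K h) ⟩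
  - (∑[ e < K ] h e) + (∑[ e < K ] h e)                 ≡⟨ ℤ.+-inverseˡ (∑[ e < K ] h e) ⟩
  + 0                                                   ∎
  where
  open ≡-Reasoning
  instance _ = prime⇒nonZero pp
  g h : ℕ → ℤ
  g d = 𝟙 (d ∣? n) * μ d
  h d = 𝟙 (¬? (p ∣? d)) * g d
  K = suc n
  M = p ℕ.* K
  K≤M : K ≤ M
  K≤M = ℕ.m≤n*m K p
  h-vanishes : ∀ d → K ≤ d → h d ≡ + 0
  h-vanishes d n<d = trans (cong (_*_ (𝟙 (¬? (p ∣? d)))) (divisorTerm-vanishes d n<d)) (ℤ.*-zeroʳ (𝟙 (¬? (p ∣? d))))

𝟙-∣-gcd : ∀ d a b → 𝟙 (d ∣? gcd a b) ≡ 𝟙 (d ∣? a) * 𝟙 (d ∣? b)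
𝟙-∣-gcd d a b = trans
  (𝟙-cong (d ∣? gcd a b) ((d ∣? a) ×-dec (d ∣? b))
    (λ d∣g → ∣-trans d∣g (gcd[m,n]∣m a b) , ∣-trans d∣g (gcd[m,n]∣n a b)) (uncurry gcd-greatest))
  (𝟙-× (d ∣? a) (d ∣? b))

coprime-as-∑ : ∀ a b N → suc a ≤ N →
  𝟙 (gcd (suc a) b ≟ 1) ≡ ∑[ i < N ] μ (suc i) * (𝟙 (suc i ∣? suc a) * 𝟙 (suc i ∣? b))
coprime-as-∑ a b N 1+a≤N = begin
  𝟙 (gcd (suc a) b ≟ 1)                                          ≡⟨ ∑-μ-divisors g (suc N) (s≤s g≤N) ⟨
  𝟙 (0 ∣? g) * μ 0 + (∑[ i < N ] 𝟙 (suc i ∣? g) * μ (suc i))     ≡⟨ cong (λ x → x + (∑[ i < N ] 𝟙 (suc i ∣? g) * μ (suc i))) (ℤ.*-zeroʳ (𝟙 (0 ∣? g))) ⟩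
  + 0 + (∑[ i < N ] 𝟙 (suc i ∣? g) * μ (suc i))                  ≡⟨ ℤ.+-identityˡ _ ⟩
  ∑[ i < N ] 𝟙 (suc i ∣? g) * μ (suc i)                          ≡⟨ ∑-cong N (λ i _ → trans (ℤ.*-comm _ (μ (suc i))) (cong (_*_ (μ (suc i))) (𝟙-∣-gcd (suc i) (suc a) b))) ⟩
  ∑[ i < N ] μ (suc i) * (𝟙 (suc i ∣? suc a) * 𝟙 (suc i ∣? b))  ∎
  where
  open ≡-Reasoning
  g = gcd (suc a) b
  instance _ = ℕ.≢-nonZero (gcd[m,n]≢0 (suc a) b (inj₁ λ ()))
  g≤N : g ≤ N
  g≤N = ℕ.≤-trans (∣⇒≤ (gcd[m,n]∣m (suc a) b)) 1+a≤N

multiples-count : ∀ d .{{_ : NonZero d}} m → ∑[ b < suc m ] 𝟙 (d ∣? b) ≡ + suc (m / d)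
multiples-count d m = go m (<-wellFounded m)
  where
  only-zero : ∀ L → 0 < L → L ≤ d → ∑[ b < L ] 𝟙 (d ∣? b) ≡ + 1
  only-zero L 0<L L≤d = trans (∑-cong L (λ b _ → sym (ℤ.*-identityʳ (𝟙 (d ∣? b))))) (∑-multiples-below d L (λ _ → + 1) 0<L L≤d)
  go : ∀ m → Acc _<_ m → ∑[ b < suc m ] 𝟙 (d ∣? b) ≡ + suc (m / d)
  go m (acc rec) with m <? d
  ... | yes m<d = trans (only-zero (suc m) z<s m<d) (cong (+_ ∘ suc) (sym (m<n⇒m/n≡0 m<d)))
  ... | no  m≮d = begin
    ∑[ b < suc m ] 𝟙 (d ∣? b)                                       ≡⟨ cong (λ L → ∑[ b < L ] 𝟙 (d ∣? b)) 1+m≡d+1+r ⟩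
    ∑[ b < d ℕ.+ suc r ] 𝟙 (d ∣? b)                                 ≡⟨ ∑-split d (suc r) (λ b → 𝟙 (d ∣? b)) ⟩
    (∑[ b < d ] 𝟙 (d ∣? b)) + (∑[ b < suc r ] 𝟙 (d ∣? d ℕ.+ b))     ≡⟨ cong₂ _+_ (only-zero d (ℕ.>-nonZero⁻¹ d) ℕ.≤-refl) (∑-cong (suc r) (λ b _ → 𝟙-∣-+ d b)) ⟩
    + 1 + (∑[ b < suc r ] 𝟙 (d ∣? b))                               ≡⟨ cong (_+_ (+ 1)) (go r (rec r<m)) ⟩
    + suc (suc (r / d))                                             ≡⟨ cong (+_ ∘ suc) (m/n≡1+[m∸n]/n d≤m) ⟨
    + suc (m / d)                                                   ∎
    where
    open ≡-Reasoning
    d≤m = ℕ.≮⇒≥ m≮d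
    r = m ∸ d
    r<m : r < m
    r<m = ℕ.∸-monoʳ-< (ℕ.>-nonZero⁻¹ d) d≤m
    1+m≡d+1+r : suc m ≡ d ℕ.+ suc r
    1+m≡d+1+r = sym (trans (ℕ.+-suc d r) (cong suc (ℕ.m+[n∸m]≡n d≤m)))

positive-multiples-count : ∀ d .{{_ : NonZero d}} m → ∑[ a < m ] 𝟙 (d ∣? suc a) ≡ + (m / d)
positive-multiples-count d m = +-cancelˡ (+ 1) _ _
  (trans (cong (λ x → x + (∑[ a < m ] 𝟙 (d ∣? suc a))) (sym (𝟙-yes (d ∣? 0) (d ∣0)))) (multiples-count d m))

∑-∑-* : ∀ M N c (f g : ℕ → ℤ) →
  ∑[ a < M ] ∑[ b < N ] c * (f a * g b) ≡ c * ((∑[ a < M ] f a) * (∑[ b < N ] g b))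
∑-∑-* M N c f g = begin
  ∑[ a < M ] ∑[ b < N ] c * (f a * g b)     ≡⟨ ∑-cong M (λ a _ → ∑-cong N (λ b _ → sym (ℤ.*-assoc c (f a) (g b)))) ⟩
  ∑[ a < M ] ∑[ b < N ] c * f a * g b       ≡⟨ ∑-cong M (λ a _ → ∑-*ˡ N (c * f a) g) ⟩
  ∑[ a < M ] c * f a * G                    ≡⟨ ∑-*ʳ M G (λ a → c * f a) ⟩
  (∑[ a < M ] c * f a) * G                  ≡⟨ cong (_* G) (∑-*ˡ M c f) ⟩
  c * (∑[ a < M ] f a) * G                  ≡⟨ ℤ.*-assoc c _ G ⟩
  c * ((∑[ a < M ] f a) * G)                ∎
  where
  open ≡-Reasoning
  G = ∑[ b < N ] g b

coprime-pairs-count : ∀ m →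
  ∑[ a < m ] ∑[ b < suc m ] 𝟙 (gcd (suc a) b ≟ 1) ≡ ∑[ i < m ] μ (suc i) * (+ (m / suc i) * + (m / suc i ℕ.+ 1))
coprime-pairs-count m = begin
  ∑[ a < m ] ∑[ b < suc m ] 𝟙 (gcd (suc a) b ≟ 1)
    ≡⟨ ∑-cong m (λ a a<m → ∑-cong (suc m) (λ b _ → coprime-as-∑ a b m a<m)) ⟩
  ∑[ a < m ] ∑[ b < suc m ] ∑[ i < m ] term a b i
    ≡⟨ ∑-cong m (λ a _ → ∑-comm (suc m) m (term a)) ⟩
  ∑[ a < m ] ∑[ i < m ] ∑[ b < suc m ] term a b i
    ≡⟨ ∑-comm m m (λ a i → ∑[ b < suc m ] term a b i) ⟩
  ∑[ i < m ] ∑[ a < m ] ∑[ b < suc m ] term a b i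
    ≡⟨ ∑-cong m (λ i _ → ∑-∑-* m (suc m) (μ (suc i)) (λ a → 𝟙 (suc i ∣? suc a)) (λ b → 𝟙 (suc i ∣? b))) ⟩
  ∑[ i < m ] μ (suc i) * ((∑[ a < m ] 𝟙 (suc i ∣? suc a)) * (∑[ b < suc m ] 𝟙 (suc i ∣? b)))
    ≡⟨ ∑-cong m (λ i _ → cong (_*_ (μ (suc i))) (cong₂ _*_ (positive-multiples-count (suc i) m) (multiples-count (suc i) m))) ⟩
  ∑[ i < m ] μ (suc i) * (+ (m / suc i) * + suc (m / suc i))
    ≡⟨ ∑-cong m (λ i _ → cong (λ k → μ (suc i) * (+ (m / suc i) * + k)) (ℕ.+-comm 1 (m / suc i))) ⟩
  ∑[ i < m ] μ (suc i) * (+ (m / suc i) * + (m / suc i ℕ.+ 1))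
    ∎
  where
  open ≡-Reasoning
  term : ℕ → ℕ → ℕ → ℤ
  term a b i = μ (suc i) * (𝟙 (suc i ∣? suc a) * 𝟙 (suc i ∣? b))

𝟙-coprime-shift : ∀ h b → 𝟙 (gcd h (h ℕ.+ b) ≟ 1) ≡ 𝟙 (gcd h b ≟ 1)
𝟙-coprime-shift h b = 𝟙-cong (gcd h (h ℕ.+ b) ≟ 1) (gcd h b ≟ 1)
  (λ g≡1 → coprime⇒gcd≡1 λ (i∣h , i∣b) → gcd≡1⇒coprime {h} {h ℕ.+ b} g≡1 (i∣h , ∣m∣n⇒∣m+n i∣h i∣b))
  (λ g≡1 → coprime⇒gcd≡1 (Coprimality.sym (coprime-+ (Coprimality.sym (gcd≡1⇒coprime {h} {b} g≡1)))))

module _ (m : ℕ) where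

  inB? : (p : ℕ × ℕ) → Dec (proj₁ p ≤ m × proj₂ p ∸ proj₁ p ≤ m)
  inB? p = (proj₁ p ≤? m) ×-dec (proj₂ p ∸ proj₁ p ≤? m)

  fareyTerm : ℕ → ℕ → ℤ
  fareyTerm h k = 𝟙 (gcd h k ≟ 1) * 𝟙 (inB? (h , k))

  fareyTerm-shift : ∀ h b → fareyTerm h (h ℕ.+ b) ≡ 𝟙 (h ≤? m) * (𝟙 (b ≤? m) * 𝟙 (gcd h b ≟ 1))
  fareyTerm-shift h b = begin
    𝟙 (gcd h (h ℕ.+ b) ≟ 1) * 𝟙 (inB? (h , h ℕ.+ b))
      ≡⟨ cong₂ _*_ (𝟙-coprime-shift h b) (𝟙-× (h ≤? m) (h ℕ.+ b ∸ h ≤? m)) ⟩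
    𝟙 (gcd h b ≟ 1) * (𝟙 (h ≤? m) * 𝟙 (h ℕ.+ b ∸ h ≤? m))
      ≡⟨ cong (λ x → 𝟙 (gcd h b ≟ 1) * (𝟙 (h ≤? m) * 𝟙 (x ≤? m))) (ℕ.m+n∸m≡n h b) ⟩
    𝟙 (gcd h b ≟ 1) * (𝟙 (h ≤? m) * 𝟙 (b ≤? m))
      ≡⟨ rotate (𝟙 (gcd h b ≟ 1)) (𝟙 (h ≤? m)) (𝟙 (b ≤? m)) ⟩
    𝟙 (h ≤? m) * (𝟙 (b ≤? m) * 𝟙 (gcd h b ≟ 1))
      ∎
    where
    open ≡-Reasoning
    rotate : ∀ x y z → x * (y * z) ≡ y * (z * x)
    rotate = solve-∀

  FareyB-as-∑ : + length (FareyB m) ≡ ∑[ k < suc (2 ℕ.* m) ] ∑[ h < suc k ] fareyTerm h k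
  FareyB-as-∑ = begin
    + length (FareyB m)
      ≡⟨ length-filter≡∑ₗ inB? (Farey (2 ℕ.* m)) ⟩
    ∑ₗ (Farey (2 ℕ.* m)) (𝟙 ∘ inB?)
      ≡⟨ ∑ₗ-concatMap column (range 1 (2 ℕ.* m)) (𝟙 ∘ inB?) ⟩
    ∑ₗ (range 1 (2 ℕ.* m)) (λ k → ∑ₗ (column k) (𝟙 ∘ inB?))
      ≡⟨ ∑ₗ-range 1 (2 ℕ.* m) _ ⟩
    ∑[ j < 2 ℕ.* m ] ∑ₗ (column (suc j)) (𝟙 ∘ inB?)
      ≡⟨ ∑-cong (2 ℕ.* m) (λ j _ → column-as-∑ (suc j)) ⟩
    ∑[ j < 2 ℕ.* m ] ∑[ h < suc (suc j) ] fareyTerm h (suc j)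
      ≡⟨ ℤ.+-identityˡ _ ⟨
    + 0 + (∑[ j < 2 ℕ.* m ] ∑[ h < suc (suc j) ] fareyTerm h (suc j))
      -- the column k = 0 is fareyTerm 0 0 + 0, and fareyTerm 0 0 evaluates to 0 since gcd 0 0 = 0
      ≡⟨ cong (λ x → x + (∑[ j < 2 ℕ.* m ] ∑[ h < suc (suc j) ] fareyTerm h (suc j))) (ℤ.+-identityʳ (fareyTerm 0 0)) ⟨
    ∑[ k < suc (2 ℕ.* m) ] ∑[ h < suc k ] fareyTerm h k
      ∎
    where
    open ≡-Reasoning
    column : ℕ → List (ℕ × ℕ)
    column k = map (λ h → (h , k)) (filter (λ h → gcd h k ≟ 1) (range 0 k))
    column-as-∑ : ∀ k → ∑ₗ (column k) (𝟙 ∘ inB?) ≡ ∑[ h < suc k ] fareyTerm h k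
    column-as-∑ k = trans (∑ₗ-map (λ h → (h , k)) (filter (λ h → gcd h k ≟ 1) (range 0 k)) (𝟙 ∘ inB?))
                   (trans (∑ₗ-filter (λ h → gcd h k ≟ 1) (range 0 k) (λ h → 𝟙 (inB? (h , k))))
                          (∑ₗ-range 0 k (λ h → fareyTerm h k)))

  FareyB-count : + length (FareyB m) ≡ ∑[ h < suc m ] ∑[ b < suc m ] 𝟙 (gcd h b ≟ 1)
  FareyB-count = begin
    + length (FareyB m)
      ≡⟨ FareyB-as-∑ ⟩
    ∑[ k < N ] ∑[ h < suc k ] fareyTerm h k
      ≡⟨ ∑-triangle N fareyTerm ⟩
    ∑[ h < N ] ∑[ b < N ∸ h ] fareyTerm h (h ℕ.+ b)
      ≡⟨ ∑-cong N (λ h _ → trans (∑-cong (N ∸ h) (λ b _ → fareyTerm-shift h b)) (∑-*ˡ (N ∸ h) (𝟙 (h ≤? m)) (λ b → 𝟙 (b ≤? m) * 𝟙 (gcd h b ≟ 1)))) ⟩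
    ∑[ h < N ] 𝟙 (h ≤? m) * (∑[ b < N ∸ h ] 𝟙 (b ≤? m) * 𝟙 (gcd h b ≟ 1))
      ≡⟨ ∑-restrict m N (λ h → ∑[ b < N ∸ h ] 𝟙 (b ≤? m) * 𝟙 (gcd h b ≟ 1)) m<N ⟩
    ∑[ h < suc m ] ∑[ b < N ∸ h ] 𝟙 (b ≤? m) * 𝟙 (gcd h b ≟ 1)
      ≡⟨ ∑-cong (suc m) (λ h h≤m → ∑-restrict m (N ∸ h) (λ b → 𝟙 (gcd h b ≟ 1)) (m<N∸h (ℕ.≤-pred h≤m))) ⟩
    ∑[ h < suc m ] ∑[ b < suc m ] 𝟙 (gcd h b ≟ 1)
      ∎
    where
    open ≡-Reasoning
    N = suc (2 ℕ.* m)
    m<N : m < N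
    m<N = s≤s (ℕ.m≤m+n m (m ℕ.+ 0))
    m<N∸h : ∀ {h} → h ≤ m → m < N ∸ h
    m<N∸h {h} h≤m = ℕ.m+n≤o⇒m≤o∸n (suc m) {h} {N} (s≤s (ℕ.+-monoʳ-≤ m (ℕ.≤-trans h≤m (ℕ.m≤m+n m 0))))

coprime-to-0-count : ∀ m → 1 ≤ m → ∑[ b < suc m ] 𝟙 (gcd 0 b ≟ 1) ≡ + 1
coprime-to-0-count m 1≤m = ∑-single (suc m) 1 (s≤s 1≤m) (λ b _ b≢1 → 𝟙-no (gcd 0 b ≟ 1) (b≢1 ∘ trans (sym (gcd-identityˡ b))))

mainTheorem4 : (m : ℕ) → 1 < m → (+ length (FareyB m)) - (+ 1) ≡ rhs m
mainTheorem4 m 1<m = begin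
  + length (FareyB m) - + 1                                                ≡⟨ cong (_- + 1) (FareyB-count m) ⟩
  (∑[ h < suc m ] ∑[ b < suc m ] 𝟙 (gcd h b ≟ 1)) - + 1                    ≡⟨ cong (λ x → x + coprimeRows - + 1) (coprime-to-0-count m (ℕ.<⇒≤ 1<m)) ⟩
  + 1 + coprimeRows - + 1                                                  ≡⟨ xyx⁻¹≈y (+ 1) coprimeRows ⟩
  coprimeRows                                                              ≡⟨ coprime-pairs-count m ⟩
  ∑[ i < m ] μ (suc i) * (+ (m / suc i) * + (m / suc i ℕ.+ 1))             ≡⟨ ∑ₗ-upTo m _ ⟨
  rhs m                                                                    ∎
  where
  open ≡-Reasoning
  coprimeRows = ∑[ a < m ] ∑[ b < suc m ] 𝟙 (gcd (suc a) b ≟ 1)
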